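{- Let $n$, $k$, $r$ be positive integers with $r\leq n$ and $k<n$. If $k$ and $r$ are both even, then there is a $k$-regular simple graph $G$ on $n$ vertices containing a vertex set $S_r$ with $|S_r|=r$ such that the induced subgraph $G[S_r]$ has a perfect matching. -}

module Defs where

open import Data.Nat using (ℕ)
open import Data.Bool using (Bool; true; false)
open import Data.Fin using (Fin)
open import Data.Fin.Subset using (Subset; _∈_)
open import Data.List using (filter; length; allFin)
open import Data.Bool.Properties using () renaming (_≟_ to _≟ᵇ_)
open import Relation.Binary.PropositionalEquality using (_≡_; _≢_)
open import Data.Product using (Σ; _×_)

record SimpleGraph (n : ℕ) : Set where
  field
    Adj    : Fin n → Fin n → Bool
    sym    : ∀ i j → Adj i j ≡ Adj j i
    irrefl : ∀ i → Adj i i ≡ false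
open SimpleGraph public

degree : ∀ {n} → SimpleGraph n → Fin n → ℕ
degree {n} G i = length (filter (λ j → Adj G i j ≟ᵇ true) (allFin n))

IsRegular : ∀ {n} → ℕ → SimpleGraph n → Set
IsRegular k G = ∀ i → degree G i ≡ k

-- The induced subgraph G[S] has a perfect matching: a partner function M that,
-- restricted to S, is a fixed-point-free involution of S whose pairs {i, M i}
-- are edges of G (hence edges of G[S], since both ends lie in S).
HasPerfectMatching : ∀ {n} → SimpleGraph n → Subset n → Set
HasPerfectMatching {n} G S =
  Σ (Fin n → Fin n) λ M →
    ∀ i → i ∈ S →
      (M i ∈ S) × (Adj G i (M i) ≡ true) × (M (M i) ≡ i)

-- Let k = 2m and join two vertices of ℤ/n when their cyclic distance lies between 1 and m.
-- Because this connection set is invariant under e ↦ n − e, every vertex sees the same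
-- multiset of distances, so each has exactly 2m neighbours (here m < n − m since k < n).
-- Consecutive vertices are adjacent, so on the first r vertices the pairs {2i, 2i + 1}
-- form a perfect matching.
module Submission where

open import Defs
open import Data.Nat using (ℕ; _≤_; _<_)
open import Data.Nat.Base using (NonZero)
open import Data.Nat.Divisibility using (_∣_)
open import Data.Product using (Σ; _×_)
open import Data.Fin.Subset using (Subset; ∣_∣)
open import Relation.Binary.PropositionalEquality using (_≡_)

open import Data.Nat.Base using (zero; suc; _+_; _*_; _∸_; ∣_-_∣; z≤n; s≤s)
open import Data.Nat.Properties
open import Data.Nat.Divisibility using (divides)
open import Data.Bool using (Bool; true; false; _∧_; _∨_)
open import Data.Bool.Properties using (∨-comm; ∨-zeroʳ; ∧-zeroʳ) renaming (_≟_ to _≟ᵇ_)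
open import Data.Fin using (Fin; toℕ) renaming (zero to fz; suc to fs)
open import Data.Fin.Properties using (toℕ<n)
open import Data.Fin.Subset using (_∈_; inside; ⊥)
open import Data.Fin.Subset.Properties using (∉⊥; ∣⊥∣≡0)
open import Data.Vec using (_∷_; here; there)
open import Data.List using (filter; length; tabulate)
open import Data.Product using (_,_)
open import Data.Empty using (⊥-elim)
open import Function using (_∘_; id)
open import Relation.Nullary using (does)
open import Relation.Nullary.Decidable using (dec-true; dec-false)
open import Relation.Binary.PropositionalEquality as ≡ using (refl; trans; cong; cong₂; subst; module ≡-Reasoning)

bool→ℕ : Bool → ℕ
bool→ℕ true  = 1
bool→ℕ false = 0

count : (ℕ → Bool) → ℕ → ℕ
count p zero    = 0
count p (suc n) = bool→ℕ (p 0) + count (p ∘ suc) n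

length-filter-tabulate : ∀ {n} {A : Set} (f : Fin n → A) (q : A → Bool) (p : ℕ → Bool) →
  (∀ j → q (f j) ≡ p (toℕ j)) → length (filter (λ x → q x ≟ᵇ true) (tabulate f)) ≡ count p n
length-filter-tabulate {zero}  f q p q≡p = refl
length-filter-tabulate {suc n} f q p q≡p
  with q (f fz) | q≡p fz | length-filter-tabulate (f ∘ fs) q (p ∘ suc) (q≡p ∘ fs)
... | true  | eq | ih = cong₂ _+_ (cong bool→ℕ eq) ih
... | false | eq | ih = cong₂ _+_ (cong bool→ℕ eq) ih

count-last : ∀ p n → count p (suc n) ≡ count p n + bool→ℕ (p n)
count-last p zero    = +-comm (bool→ℕ (p 0)) 0
count-last p (suc n) =
  trans (cong (bool→ℕ (p 0) +_) (count-last (p ∘ suc) n)) (≡.sym (+-assoc (bool→ℕ (p 0)) _ _))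

count-+ : ∀ p a b → count p (a + b) ≡ count p a + count (p ∘ (a +_)) b
count-+ p zero    b = refl
count-+ p (suc a) b =
  trans (cong (bool→ℕ (p 0) +_) (count-+ (p ∘ suc) a b)) (≡.sym (+-assoc (bool→ℕ (p 0)) _ _))

count-true : ∀ p n → (∀ x → x < n → p x ≡ true) → count p n ≡ n
count-true p zero    _      = refl
count-true p (suc n) p-true =
  cong₂ _+_ (cong bool→ℕ (p-true 0 (s≤s z≤n))) (count-true (p ∘ suc) n (λ x → p-true (suc x) ∘ s≤s))

count-false : ∀ p n → (∀ x → x < n → p x ≡ false) → count p n ≡ 0
count-false p zero    _       = refl
count-false p (suc n) p-false =
  cong₂ _+_ (cong bool→ℕ (p-false 0 (s≤s z≤n))) (count-false (p ∘ suc) n (λ x → p-false (suc x) ∘ s≤s))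

-- Comparing i + 1 with i: the new first term g (i + 1) replaces the old last term g (N ∸ (i + 1)).
count-∣-∣ : ∀ {N} (g : ℕ → Bool) → (∀ e → e ≤ N → g e ≡ g (N ∸ e)) →
  ∀ {i} → i < N → count (λ j → g ∣ i - j ∣) N ≡ count g N
count-∣-∣ g g-reflect {zero} _ = refl
count-∣-∣ {suc n} g g-reflect {suc i} (s≤s i<n) = begin
  bool→ℕ (g (suc i)) + count gᵢ n   ≡⟨ cong (λ b → bool→ℕ b + count gᵢ n) (g-reflect (suc i) (s≤s (<⇒≤ i<n))) ⟩
  bool→ℕ (g (n ∸ i)) + count gᵢ n   ≡⟨ +-comm _ (count gᵢ n) ⟩
  count gᵢ n + bool→ℕ (g (n ∸ i))   ≡⟨ cong (λ d → count gᵢ n + bool→ℕ (g d)) (m≤n⇒∣m-n∣≡n∸m (<⇒≤ i<n)) ⟨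
  count gᵢ n + bool→ℕ (gᵢ n)        ≡⟨ count-last gᵢ n ⟨
  count gᵢ (suc n)                  ≡⟨ count-∣-∣ g g-reflect (m<n⇒m<1+n i<n) ⟩
  count g (suc n)                   ∎
  where
  open ≡-Reasoning
  gᵢ : ℕ → Bool
  gᵢ j = g ∣ i - j ∣

distanceGraph : ∀ {n} (g : ℕ → Bool) → g 0 ≡ false → SimpleGraph n
distanceGraph g g0 = record
  { Adj    = λ i j → g ∣ toℕ i - toℕ j ∣
  ; sym    = λ i j → cong g (∣-∣-comm (toℕ i) (toℕ j))
  ; irrefl = λ i → trans (cong g (∣n-n∣≡0 (toℕ i))) g0
  }

degree-distanceGraph : ∀ {n} (g : ℕ → Bool) (g0 : g 0 ≡ false) → (∀ e → e ≤ n → g e ≡ g (n ∸ e)) →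
  IsRegular (count g n) (distanceGraph {n} g g0)
degree-distanceGraph {n} g g0 g-reflect i =
  trans (length-filter-tabulate {n} id _ (λ j → g ∣ toℕ i - j ∣) (λ _ → refl)) (count-∣-∣ g g-reflect (toℕ<n i))

band : ℕ → ℕ → Bool
band m e = does (1 ≤? e) ∧ does (e ≤? m)

cyclicBand : ℕ → ℕ → ℕ → Bool
cyclicBand N m e = band m e ∨ band m (N ∸ e)

band-true : ∀ {m e} → 1 ≤ e → e ≤ m → band m e ≡ true
band-true {m} {e} 1≤e e≤m rewrite dec-true (1 ≤? e) 1≤e | dec-true (e ≤? m) e≤m = refl

band-false : ∀ {m e} → m < e → band m e ≡ false
band-false {m} {e} m<e = trans (cong (does (1 ≤? e) ∧_) (dec-false (e ≤? m) (<⇒≱ m<e))) (∧-zeroʳ _)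

cyclicBand-reflect : ∀ {N} m {e} → e ≤ N → cyclicBand N m e ≡ cyclicBand N m (N ∸ e)
cyclicBand-reflect {N} m {e} e≤N rewrite m∸[m∸n]≡n e≤N = ∨-comm (band m e) (band m (N ∸ e))

cyclicBand-zero : ∀ {N m} → m < N → cyclicBand N m 0 ≡ false
cyclicBand-zero m<N = band-false m<N

-- Residues modulo N = 1 + m + t + m: 0, then m in the band, t outside it, m in the band again.
count-cyclicBand-split : ∀ m t → count (cyclicBand (suc (m + (t + m))) m) (suc (m + (t + m))) ≡ m + m
count-cyclicBand-split m t = begin
  count p (suc (m + (t + m)))
    ≡⟨ cong₂ _+_ (cong bool→ℕ (cyclicBand-zero (s≤s (m≤m+n m (t + m))))) (count-+ (p ∘ suc) m (t + m)) ⟩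
  count (p ∘ suc) m + count (p ∘ suc ∘ (m +_)) (t + m)
    ≡⟨ cong₂ _+_ (count-true _ m low) (count-+ _ t m) ⟩
  m + (count (p ∘ suc ∘ (m +_)) t + count (p ∘ suc ∘ (m +_) ∘ (t +_)) m)
    ≡⟨ cong (m +_) (cong₂ _+_ (count-false _ t middle) (count-true _ m high)) ⟩
  m + m ∎
  where
  open ≡-Reasoning
  N : ℕ
  N = suc (m + (t + m))
  p : ℕ → Bool
  p = cyclicBand N m

  low : ∀ x → x < m → p (suc x) ≡ true
  low x x<m = cong (_∨ band m (N ∸ suc x)) (band-true (s≤s z≤n) x<m)

  middle : ∀ x → x < t → p (suc (m + x)) ≡ false
  middle x x<t = cong₂ _∨_ (band-false (s≤s (m≤m+n m x))) (band-false m<N∸e)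
    where
    m<N∸e : m < N ∸ suc (m + x)
    m<N∸e = subst (m <_) (≡.sym N∸e≡[t∸x]+m) (m<n+m m (m<n⇒0<n∸m x<t))
      where
      N∸e≡[t∸x]+m : N ∸ suc (m + x) ≡ (t ∸ x) + m
      N∸e≡[t∸x]+m = trans ([m+n]∸[m+o]≡n∸o m (t + m) x) (+-∸-comm m (<⇒≤ x<t))

  high : ∀ x → x < m → p (suc (m + (t + x))) ≡ true
  high x x<m = trans (cong (band m (suc (m + (t + x))) ∨_) (band-true 1≤N∸e N∸e≤m)) (∨-zeroʳ _)
    where
    N∸e≡m∸x : N ∸ suc (m + (t + x)) ≡ m ∸ x
    N∸e≡m∸x = trans ([m+n]∸[m+o]≡n∸o m (t + m) (t + x)) ([m+n]∸[m+o]≡n∸o t m x)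
    1≤N∸e : 1 ≤ N ∸ suc (m + (t + x))
    1≤N∸e = subst (1 ≤_) (≡.sym N∸e≡m∸x) (m<n⇒0<n∸m x<m)
    N∸e≤m : N ∸ suc (m + (t + x)) ≤ m
    N∸e≤m = subst (_≤ m) (≡.sym N∸e≡m∸x) (m∸n≤m m x)

count-cyclicBand : ∀ {N m} → m + m < N → count (cyclicBand N m) N ≡ m + m
count-cyclicBand {N} {m} 2m<N =
  subst (λ N → count (cyclicBand N m) N ≡ m + m) N≡1+m+t+m (count-cyclicBand-split m t)
  where
  t : ℕ
  t = N ∸ suc (m + m)
  N≡1+m+t+m : suc (m + (t + m)) ≡ N
  N≡1+m+t+m = trans (cong (λ x → suc (m + x)) (+-comm t m))
                    (trans (cong suc (≡.sym (+-assoc m m t))) (m+[n∸m]≡n 2m<N))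

partner : ∀ {n} → Fin n → Fin n
partner {suc zero}    fz           = fz
partner {suc (suc n)} fz           = fs fz
partner {suc (suc n)} (fs fz)      = fz
partner {suc (suc n)} (fs (fs i))  = fs (fs (partner i))

partner-involutive : ∀ {n} (i : Fin n) → partner (partner i) ≡ i
partner-involutive {suc zero}    fz          = refl
partner-involutive {suc (suc n)} fz          = refl
partner-involutive {suc (suc n)} (fs fz)     = refl
partner-involutive {suc (suc n)} (fs (fs i)) = cong (fs ∘ fs) (partner-involutive i)

pairs : ∀ n → ℕ → Subset n
pairs (suc (suc n)) (suc p) = inside ∷ inside ∷ pairs n p
pairs _             _       = ⊥

∣pairs∣ : ∀ n p → p * 2 ≤ n → ∣ pairs n p ∣ ≡ p * 2
∣pairs∣ zero          zero    _                 = refl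
∣pairs∣ (suc zero)    zero    _                 = refl
∣pairs∣ (suc (suc n)) zero    _                 = ∣⊥∣≡0 (suc (suc n))
∣pairs∣ (suc zero)    (suc p) (s≤s ())
∣pairs∣ (suc (suc n)) (suc p) (s≤s (s≤s 2p≤n)) = cong (suc ∘ suc) (∣pairs∣ n p 2p≤n)

partner-∈-pairs : ∀ n p (i : Fin n) → i ∈ pairs n p → partner i ∈ pairs n p × ∣ toℕ i - toℕ (partner i) ∣ ≡ 1
partner-∈-pairs (suc (suc n)) (suc p) fz          here               = there here , refl
partner-∈-pairs (suc (suc n)) (suc p) (fs fz)     (there here)       = here , refl
partner-∈-pairs (suc (suc n)) (suc p) (fs (fs i)) (there (there i∈)) with partner-∈-pairs n p i i∈
... | partner∈ , distance = there (there partner∈) , distance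
partner-∈-pairs (suc zero)    p       i i∈ = ⊥-elim (∉⊥ i∈)
partner-∈-pairs (suc (suc n)) zero    i i∈ = ⊥-elim (∉⊥ i∈)

distanceGraph-matching : ∀ {n} (g : ℕ → Bool) (g0 : g 0 ≡ false) → g 1 ≡ true →
  ∀ p → HasPerfectMatching (distanceGraph {n} g g0) (pairs n p)
distanceGraph-matching {n} g g0 g1 p = partner , matched
  where
  matched : ∀ i → i ∈ pairs n p →
    (partner i ∈ pairs n p) × (g ∣ toℕ i - toℕ (partner i) ∣ ≡ true) × (partner (partner i) ≡ i)
  matched i i∈ with partner-∈-pairs n p i i∈
  ... | partner∈ , distance = partner∈ , trans (cong g distance) g1 , partner-involutive i

lemma4p1 : (n k r : ℕ) → NonZero n → NonZero k → NonZero r → r ≤ n → k < n → 2 ∣ k → 2 ∣ r → Σ (SimpleGraph n) λ G → IsRegular k G × Σ (Subset n) λ S → (∣ S ∣ ≡ r) × HasPerfectMatching G S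
lemma4p1 n _ _ _ () _ _ _ (divides zero refl) _
lemma4p1 n _ _ _ _ _ r≤n k<n (divides (suc m) refl) (divides p refl) =
  G , regular , pairs n p , ∣pairs∣ n p r≤n , distanceGraph-matching g g0 refl p
  where
  g : ℕ → Bool
  g = cyclicBand n (suc m)
  2m≡k : suc m + suc m ≡ suc m * 2
  2m≡k = ≡.sym (trans (*-suc (suc m) 1) (cong (suc m +_) (*-identityʳ (suc m))))
  2m<n : suc m + suc m < n
  2m<n = subst (_< n) (≡.sym 2m≡k) k<n
  g0 : g 0 ≡ false
  g0 = cyclicBand-zero (≤-<-trans (m≤m+n (suc m) (suc m)) 2m<n)
  G : SimpleGraph n
  G = distanceGraph g g0
  regular : IsRegular (suc m * 2) G
  regular i = trans (degree-distanceGraph g g0 (λ _ → cyclicBand-reflect (suc m)) i)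
                    (trans (count-cyclicBand 2m<n) 2m≡k)
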